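{- Let $d\ge1$ and let $C$ be a $d$-dimensional coboundary over $\mathbb{F}_2$ on vertex set $[n]$. Suppose that for some vertex $v$ the $(d-1)$-complex $K={\rm link}_v(C)$ is $\Lambda$-connected. Then $C$ is a $d$-hypercut.
   Context: Over $\mathbb{F}_2$, $d$-faces are $(d+1)$-subsets of $[n]$ and $(d-1)$-faces are $d$-subsets. A $d$-coboundary is a set of $d$-faces of the form $\{\sigma:\ |\{\tau\in A:\tau\subset\sigma\}|\text{ odd}\}$ for some set $A$ of $(d-1)$-faces. A $d$-hypercut is an inclusion-minimal nonempty $d$-coboundary (equivalently, an inclusion-minimal set of $d$-faces meeting every maximal $\mathbb{F}_2$-acyclic set of $d$-faces). ${\rm link}_v(C)$ is the set of $(d-1)$-faces $\tau\subseteq[n]\setminus\{v\}$ with $\tau\cup\{v\}\in C$. Two $(d-1)$-faces $\tau,\tau'$ of $K$ are $\Lambda$-adjacent if $\sigma=\tau\cup\tau'$ has $d+1$ elements and $\tau,\tau'$ are the only $d$-element subsets of $\sigma$ lying in $K$. $K$ is $\Lambda$-connected if the transitive closure of $\Lambda$-adjacency on the faces of $K$ has exactly one class. -}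

module Defs where

open import Data.Nat using (ℕ; suc; _≟_)
open import Data.Bool using (Bool; true; false; _∧_; _xor_; not)
open import Data.Fin using (Fin)
open import Data.Fin.Subset using (Subset; ∣_∣; _⊆_; _∪_; ⁅_⁆; _∉_; inside; outside)
open import Data.Fin.Subset.Properties using (_⊆?_; _∈?_)
open import Data.Vec using (_∷_; [])
open import Data.List using (List; []; _∷_; map; _++_; foldr)
open import Data.Product using (Σ; ∃; _×_)
open import Data.Sum using (_⊎_)
open import Relation.Binary.PropositionalEquality using (_≡_)
open import Relation.Nullary.Decidable using (⌊_⌋)
open import Relation.Binary.Construct.Closure.ReflexiveTransitive using (Star)

FaceSet : ℕ → Set
FaceSet n = Subset n → Bool

_∈F_ : ∀ {n} → Subset n → FaceSet n → Set
σ ∈F A = A σ ≡ true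

_⊆F_ : ∀ {n} → FaceSet n → FaceSet n → Set
A ⊆F B = ∀ σ → σ ∈F A → σ ∈F B

-- A face set is a set of (k-1)-faces, i.e. all its members are k-subsets.
OfSize : ∀ {n} → ℕ → FaceSet n → Set
OfSize k A = ∀ σ → σ ∈F A → ∣ σ ∣ ≡ k

allSubsets : (n : ℕ) → List (Subset n)
allSubsets ℕ.zero = [] ∷ []
allSubsets (suc n) =
  map (outside ∷_) (allSubsets n) ++ map (inside ∷_) (allSubsets n)

oddIncidence : ∀ {n} → FaceSet n → Subset n → Bool
oddIncidence {n} A σ =
  foldr (λ τ b → (A τ ∧ ⌊ τ ⊆? σ ⌋) xor b) false (allSubsets n)

-- The coboundary δA of a set A of (d-1)-faces (d-subsets): the set of
-- d-faces ((d+1)-subsets) σ containing an odd number of members of A.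
coboundaryOf : ∀ {n} → ℕ → FaceSet n → FaceSet n
coboundaryOf d A σ = ⌊ ∣ σ ∣ ≟ suc d ⌋ ∧ oddIncidence A σ

IsCoboundary : ∀ {n} → ℕ → FaceSet n → Set
IsCoboundary {n} d C =
  Σ (FaceSet n) λ A → OfSize d A × (∀ σ → C σ ≡ coboundaryOf d A σ)

NonemptyF : ∀ {n} → FaceSet n → Set
NonemptyF {n} C = ∃ λ (σ : Subset n) → σ ∈F C

IsHypercut : ∀ {n} → ℕ → FaceSet n → Set
IsHypercut d C =
  IsCoboundary d C × NonemptyF C ×
  (∀ C' → IsCoboundary d C' → NonemptyF C' → C' ⊆F C → C ⊆F C')

link : ∀ {n} → Fin n → FaceSet n → FaceSet n
link v C τ = not ⌊ v ∈? τ ⌋ ∧ C (τ ∪ ⁅ v ⁆)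

ΛAdjacent : ∀ {n} → ℕ → FaceSet n → Subset n → Subset n → Set
ΛAdjacent {n} d K τ τ' =
  τ ∈F K × τ' ∈F K × ∣ τ ∪ τ' ∣ ≡ suc d ×
  (∀ (ρ : Subset n) → ∣ ρ ∣ ≡ d → ρ ⊆ (τ ∪ τ') → ρ ∈F K → (ρ ≡ τ) ⊎ (ρ ≡ τ'))

-- Λ-connected: the transitive closure of Λ-adjacency on the faces of K has
-- exactly one class (K nonempty and any two faces are joined by a Λ-path).
ΛConnected : ∀ {n} → ℕ → FaceSet n → Set
ΛConnected d K =
  NonemptyF K × (∀ τ τ' → τ ∈F K → τ' ∈F K → Star (ΛAdjacent d K) τ τ')

module Submission where

-- The whole argument rests on the cocycle identity δC = 0 evaluated on a
-- (d+2)-set σ ∪ {v}: for a d-coboundary C and a (d+1)-set σ with v ∉ σ,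
--
--     C σ  =  Σ { [ρ ∈ link_v C] : ρ a d-subset of σ }      (over F₂).
--
-- Together with C (τ ∪ {v}) = [τ ∈ link_v C] this shows that a coboundary
-- is determined by its link at v.  Now let C' ⊆ C be a nonempty
-- coboundary.  Its link is nonempty and contained in link_v C.  If τ, τ'
-- are Λ-adjacent in link_v C, they are the only faces of σ = τ ∪ τ' in
-- link_v C, so the identity gives C σ = 1 + 1 = 0, hence C' σ = 0, hence
-- [τ ∈ link_v C'] = [τ' ∈ link_v C'].  By Λ-connectivity link_v C' is all
-- of link_v C, so C' = C: C is inclusion-minimal.  (The argument does not
-- need the hypothesis d ≥ 1.)

open import Defs
open import Data.Nat using (ℕ; zero; suc; _≥_; _≟_)
open import Data.Nat.Properties using (suc-injective; 1+n≰n; ≤-trans; ≤-reflexive)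
open import Data.Bool using (Bool; true; false; _∧_; _xor_; not)
open import Data.Bool.Properties
  using ( ∧-comm; ∧-zeroʳ; ∧-identityʳ; ∧-distribˡ-xor; ∨-identityʳ; ¬-not
        ; not-involutive; not-distribˡ-xor; xor-assoc; xor-comm; xor-same
        ; xor-identityʳ; xor-inverseʳ; xor-annihilates-not
        ; xor-∧-commutativeRing; ∧-commutativeMonoid )
import Data.Bool.Properties as Bool
open import Data.Fin using (Fin; zero; suc)
open import Data.Fin.Subset using (Subset; ∣_∣; _∈_; _∉_; _⊆_; _∪_; ⁅_⁆; inside; outside)
open import Data.Fin.Subset.Properties
  using ( _⊆?_; _∈?_; p⊆q⇒∣p∣≤∣q∣; p⊆p∪q; q⊆p∪q; x∈p∪q⁻
        ; x∈⁅x⁆; x∈⁅y⁆⇒x≡y; ∪-idem; ∪-identityʳ )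
open import Data.Vec using (_∷_; [])
open import Data.Vec.Base using (here; there)
open import Data.Vec.Properties using (≡-dec; ∷-injectiveʳ)
open import Data.List using (List; []; _∷_; _++_; map; foldr)
open import Data.Product using (∃; _×_; _,_; proj₁; proj₂)
open import Data.Sum using (_⊎_; inj₁; inj₂)
open import Data.Empty using (⊥-elim)
open import Function using (_∘_)
open import Function.Bundles using (mk⇔)
open import Algebra.Bundles using (CommutativeRing; CommutativeMonoid)
open import Algebra.Properties.CommutativeSemigroup
  (CommutativeRing.+-commutativeSemigroup xor-∧-commutativeRing)
  using () renaming (interchange to xor-interchange)
open import Algebra.Properties.CommutativeSemigroup
  (CommutativeMonoid.commutativeSemigroup ∧-commutativeMonoid)
  using () renaming (x∙yz≈y∙xz to ∧-swapˡ)
open import Relation.Nullary using (Dec; does; yes; no)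
open import Relation.Nullary.Decidable using (isYes≗does; dec-true; dec-false; does-⇔)
open import Relation.Binary.PropositionalEquality
open import Relation.Binary.Construct.Closure.ReflexiveTransitive using (Star; fold)
open ≡-Reasoning

private
  variable
    X Y : Set
    n d : ℕ

fromDoes : {P : Set} (p? : Dec P) → does p? ≡ true → P
fromDoes (yes p) _ = p
fromDoes (no _)  ()

true≢false : true ≢ false
true≢false ()

∧-elimˡ : ∀ a b → a ∧ b ≡ true → a ≡ true
∧-elimˡ true _ _ = refl

∧-elimʳ : ∀ a b → a ∧ b ≡ true → b ≡ true
∧-elimʳ true _ e = e

∧-cong-if : ∀ a {b c} → (a ≡ true → b ≡ c) → a ∧ b ≡ a ∧ c
∧-cong-if true  b≡c = b≡c refl
∧-cong-if false _   = refl

xor-false⇒≡ : ∀ a b → a xor b ≡ false → a ≡ b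
xor-false⇒≡ true  true  _ = refl
xor-false⇒≡ false false _ = refl

∧-split-xor : ∀ a e → a ≡ (a ∧ e) xor (a ∧ not e)
∧-split-xor a e = begin
  a                           ≡⟨ ∧-identityʳ a ⟨
  a ∧ true                    ≡⟨ cong (a ∧_) (xor-inverseʳ e) ⟨
  a ∧ (e xor not e)           ≡⟨ ∧-distribˡ-xor a e (not e) ⟩
  (a ∧ e) xor (a ∧ not e)     ∎

isOdd : ℕ → Bool
isOdd zero    = false
isOdd (suc k) = not (isOdd k)

xorSum : List X → (X → Bool) → Bool
xorSum L f = foldr (λ x b → f x xor b) false L

xorSum-cong : (L : List X) {f g : X → Bool} → (∀ x → f x ≡ g x) →
              xorSum L f ≡ xorSum L g
xorSum-cong []      _   = refl
xorSum-cong (x ∷ L) f≗g = cong₂ _xor_ (f≗g x) (xorSum-cong L f≗g)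

xorSum-zero : (L : List X) {f : X → Bool} → (∀ x → f x ≡ false) →
              xorSum L f ≡ false
xorSum-zero []      _    = refl
xorSum-zero (x ∷ L) f≗0 rewrite f≗0 x = xorSum-zero L f≗0

xorSum-++ : (L M : List X) (f : X → Bool) →
            xorSum (L ++ M) f ≡ xorSum L f xor xorSum M f
xorSum-++ []      M f = refl
xorSum-++ (x ∷ L) M f =
  trans (cong (f x xor_) (xorSum-++ L M f)) (sym (xor-assoc (f x) _ _))

xorSum-map : (L : List X) (g : X → Y) (f : Y → Bool) →
             xorSum (map g L) f ≡ xorSum L (f ∘ g)
xorSum-map []      g f = refl
xorSum-map (x ∷ L) g f = cong (f (g x) xor_) (xorSum-map L g f)

xorSum-xor : (L : List X) (f g : X → Bool) →
             xorSum L (λ x → f x xor g x) ≡ xorSum L f xor xorSum L g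
xorSum-xor []      f g = refl
xorSum-xor (x ∷ L) f g =
  trans (cong ((f x xor g x) xor_) (xorSum-xor L f g))
        (xor-interchange (f x) (g x) (xorSum L f) (xorSum L g))

xorSum-scale : (L : List X) (b : Bool) (f : X → Bool) →
               b ∧ xorSum L f ≡ xorSum L (λ x → b ∧ f x)
xorSum-scale L true  f = refl
xorSum-scale L false f = sym (xorSum-zero L (λ _ → refl))

xorSum-swap : (L : List X) (M : List Y) (f : X → Y → Bool) →
              xorSum L (λ x → xorSum M (f x)) ≡ xorSum M (λ y → xorSum L (λ x → f x y))
xorSum-swap []      M f = sym (xorSum-zero M (λ _ → refl))
xorSum-swap (x ∷ L) M f =
  trans (cong (xorSum M (f x) xor_) (xorSum-swap L M f))
        (sym (xorSum-xor M (f x) (λ y → xorSum L (λ x' → f x' y))))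

xorSum-witness : (L : List X) (f : X → Bool) → xorSum L f ≡ true → ∃ λ x → f x ≡ true
xorSum-witness (x ∷ L) f odd with f x in fx
... | true  = x , fx
... | false = xorSum-witness L f odd

⊕ : (Subset n → Bool) → Bool
⊕ {n} = xorSum (allSubsets n)

⊕-cong : {f g : Subset n → Bool} → (∀ ρ → f ρ ≡ g ρ) → ⊕ f ≡ ⊕ g
⊕-cong {n} = xorSum-cong (allSubsets n)

⊕-zero : (f : Subset n → Bool) → (∀ ρ → f ρ ≡ false) → ⊕ f ≡ false
⊕-zero {n} f = xorSum-zero (allSubsets n)

⊕-split : (f : Subset (suc n) → Bool) →
          ⊕ f ≡ ⊕ (λ ρ → f (outside ∷ ρ)) xor ⊕ (λ ρ → f (inside ∷ ρ))
⊕-split {n} f = trans (xorSum-++ (map (outside ∷_) S) (map (inside ∷_) S) f)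
                      (cong₂ _xor_ (xorSum-map S (outside ∷_) f) (xorSum-map S (inside ∷_) f))
  where S = allSubsets n

⊕-outside : (f : Subset (suc n) → Bool) → (∀ ρ → f (inside ∷ ρ) ≡ false) →
            ⊕ f ≡ ⊕ (λ ρ → f (outside ∷ ρ))
⊕-outside f f-in≗0 = trans (⊕-split f)
  (trans (cong (⊕ (λ ρ → f (outside ∷ ρ)) xor_) (⊕-zero (λ ρ → f (inside ∷ ρ)) f-in≗0))
         (xor-identityʳ _))

⊕-inside : (f : Subset (suc n) → Bool) → (∀ ρ → f (outside ∷ ρ) ≡ false) →
           ⊕ f ≡ ⊕ (λ ρ → f (inside ∷ ρ))
⊕-inside f f-out≗0 = trans (⊕-split f)
  (cong (_xor ⊕ (λ ρ → f (inside ∷ ρ))) (⊕-zero (λ ρ → f (outside ∷ ρ)) f-out≗0))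

⊕-single : (f : Subset n → Bool) (a : Subset n) →
           (∀ ρ → f ρ ≡ true → ρ ≡ a) → ⊕ f ≡ f a
⊕-single {zero}  f []            _    = xor-identityʳ (f [])
⊕-single {suc n} f (outside ∷ a) only = trans
  (⊕-outside f (λ ρ → ¬-not (λ e → case (only (inside ∷ ρ) e))))
  (⊕-single _ a (λ ρ e → ∷-injectiveʳ (only (outside ∷ ρ) e)))
  where case : ∀ {ρ} → inside ∷ ρ ≢ outside ∷ a
        case ()
⊕-single {suc n} f (inside ∷ a) only = trans
  (⊕-inside f (λ ρ → ¬-not (λ e → case (only (outside ∷ ρ) e))))
  (⊕-single _ a (λ ρ e → ∷-injectiveʳ (only (inside ∷ ρ) e)))
  where case : ∀ {ρ} → outside ∷ ρ ≢ inside ∷ a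
        case ()

⊕-pair : {f : Subset n → Bool} {a b : Subset n} → a ≢ b →
         (∀ ρ → f ρ ≡ true → ρ ≡ a ⊎ ρ ≡ b) → ⊕ f ≡ f a xor f b
⊕-pair {n} {f} {a} {b} a≢b only = begin
  ⊕ f
    ≡⟨ ⊕-cong (λ ρ → ∧-split-xor (f ρ) (is-a ρ)) ⟩
  ⊕ (λ ρ → at-a ρ xor off-a ρ)
    ≡⟨ xorSum-xor (allSubsets n) at-a off-a ⟩
  ⊕ at-a xor ⊕ off-a
    ≡⟨ cong₂ _xor_ (⊕-single at-a a at-a-only) (⊕-single off-a b off-a-only) ⟩
  (f a ∧ is-a a) xor (f b ∧ not (is-a b))
    ≡⟨ cong₂ (λ x y → (f a ∧ x) xor (f b ∧ not y))
             (dec-true (a ≟ₛ a) refl) (dec-false (b ≟ₛ a) (a≢b ∘ sym)) ⟩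
  (f a ∧ true) xor (f b ∧ true)
    ≡⟨ cong₂ _xor_ (∧-identityʳ (f a)) (∧-identityʳ (f b)) ⟩
  f a xor f b
    ∎
  where
  _≟ₛ_ : (p q : Subset n) → Dec (p ≡ q)
  _≟ₛ_ = ≡-dec Bool._≟_
  is-a : Subset n → Bool
  is-a ρ = does (ρ ≟ₛ a)
  at-a off-a : Subset n → Bool
  at-a  ρ = f ρ ∧ is-a ρ
  off-a ρ = f ρ ∧ not (is-a ρ)
  at-a-only : ∀ ρ → at-a ρ ≡ true → ρ ≡ a
  at-a-only ρ e = fromDoes (ρ ≟ₛ a) (∧-elimʳ (f ρ) _ e)
  off-a-only : ∀ ρ → off-a ρ ≡ true → ρ ≡ b
  off-a-only ρ e with only ρ (∧-elimˡ (f ρ) _ e)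
  ... | inj₂ ρ≡b = ρ≡b
  ... | inj₁ ρ≡a
    with () ← trans (cong not (sym (dec-true (ρ ≟ₛ a) ρ≡a))) (∧-elimʳ (f ρ) _ e)

_⊆ᵇ_ : Subset n → Subset n → Bool
p ⊆ᵇ q = does (p ⊆? q)

face : ℕ → Subset n → Subset n → Bool
face k σ ρ = ρ ⊆ᵇ σ ∧ does (∣ ρ ∣ ≟ k)

face-intro : ∀ {k} (σ ρ : Subset n) → ρ ⊆ σ → ∣ ρ ∣ ≡ k → face k σ ρ ≡ true
face-intro σ ρ ρ⊆σ ρ-size =
  cong₂ _∧_ (dec-true (ρ ⊆? σ) ρ⊆σ) (dec-true (∣ ρ ∣ ≟ _) ρ-size)

face-elim : ∀ {k} (σ ρ : Subset n) → face k σ ρ ≡ true → ρ ⊆ σ × ∣ ρ ∣ ≡ k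
face-elim {k = k} σ ρ e =
  fromDoes (ρ ⊆? σ) (∧-elimˡ _ _ e) , fromDoes (∣ ρ ∣ ≟ k) (∧-elimʳ (ρ ⊆ᵇ σ) _ e)

∣cone∣ : ∀ {v : Fin n} {τ} → v ∉ τ → ∣ τ ∪ ⁅ v ⁆ ∣ ≡ suc ∣ τ ∣
∣cone∣ {v = zero}  {outside ∷ τ} _   = cong (suc ∘ ∣_∣) (∪-identityʳ τ)
∣cone∣ {v = zero}  {inside  ∷ τ} v∉τ = ⊥-elim (v∉τ here)
∣cone∣ {v = suc v} {outside ∷ τ} v∉τ = ∣cone∣ (v∉τ ∘ there)
∣cone∣ {v = suc v} {inside  ∷ τ} v∉τ = cong suc (∣cone∣ (v∉τ ∘ there))

split-off : ∀ {v : Fin n} {τ} → v ∈ τ → ∃ λ τ₀ → v ∉ τ₀ × τ₀ ∪ ⁅ v ⁆ ≡ τ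
split-off {v = zero} {inside ∷ τ} here = outside ∷ τ , (λ ()) , cong (inside ∷_) (∪-identityʳ τ)
split-off {v = suc v} {s ∷ τ} (there v∈τ) with split-off v∈τ
... | τ₀ , v∉τ₀ , τ₀+v≡τ =
  s ∷ τ₀ , (λ { (there v∈τ₀) → v∉τ₀ v∈τ₀ }) , cong₂ _∷_ (∨-identityʳ s) τ₀+v≡τ

⊆-cone⁻ : ∀ {v : Fin n} {τ ρ} → v ∉ τ → τ ⊆ ρ ∪ ⁅ v ⁆ → τ ⊆ ρ
⊆-cone⁻ {v = v} {τ} {ρ} v∉τ τ⊆ρ+v {x} x∈τ with x∈p∪q⁻ ρ ⁅ v ⁆ (τ⊆ρ+v x∈τ)
... | inj₁ x∈ρ  = x∈ρ
... | inj₂ x∈⁅v⁆ = ⊥-elim (v∉τ (subst (_∈ τ) (x∈⁅y⁆⇒x≡y v x∈⁅v⁆) x∈τ))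

⊆ᵇ-cone : ∀ {v : Fin n} {τ} ρ → v ∉ τ → τ ⊆ᵇ (ρ ∪ ⁅ v ⁆) ≡ τ ⊆ᵇ ρ
⊆ᵇ-cone {v = v} {τ} ρ v∉τ = does-⇔
  (mk⇔ (⊆-cone⁻ v∉τ) (λ τ⊆ρ x∈τ → p⊆p∪q ⁅ v ⁆ (τ⊆ρ x∈τ))) (τ ⊆? ρ ∪ ⁅ v ⁆) (τ ⊆? ρ)

⊆ᵇ-cones : ∀ {v : Fin n} {τ} ρ → v ∉ τ → (τ ∪ ⁅ v ⁆) ⊆ᵇ (ρ ∪ ⁅ v ⁆) ≡ τ ⊆ᵇ ρ
⊆ᵇ-cones {v = v} {τ} ρ v∉τ = does-⇔ (mk⇔ shrink grow) (τ ∪ ⁅ v ⁆ ⊆? ρ ∪ ⁅ v ⁆) (τ ⊆? ρ)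
  where
  shrink : τ ∪ ⁅ v ⁆ ⊆ ρ ∪ ⁅ v ⁆ → τ ⊆ ρ
  shrink τ+v⊆ρ+v = ⊆-cone⁻ v∉τ (λ x∈τ → τ+v⊆ρ+v (p⊆p∪q ⁅ v ⁆ x∈τ))
  grow : τ ⊆ ρ → τ ∪ ⁅ v ⁆ ⊆ ρ ∪ ⁅ v ⁆
  grow τ⊆ρ x∈τ+v with x∈p∪q⁻ τ ⁅ v ⁆ x∈τ+v
  ... | inj₁ x∈τ   = p⊆p∪q ⁅ v ⁆ (τ⊆ρ x∈τ)
  ... | inj₂ x∈⁅v⁆ = q⊆p∪q ρ ⁅ v ⁆ x∈⁅v⁆

interval : ℕ → Subset n → Subset n → Subset n → Bool
interval k τ σ ρ = τ ⊆ᵇ ρ ∧ face k σ ρ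

-- If ρ ⊇ τ, then inside ∷ ρ has more than ∣ τ ∣ elements, so it does not
-- lie in an interval of ∣ τ ∣-element sets above outside ∷ τ.
interval-too-large : (τ σ ρ : Subset n) (s : Bool) →
                     interval ∣ τ ∣ (outside ∷ τ) (s ∷ σ) (inside ∷ ρ) ≡ false
interval-too-large τ σ ρ s with τ ⊆? ρ
... | no  _   = refl
... | yes τ⊆ρ = trans (cong ((inside ∷ ρ) ⊆ᵇ (s ∷ σ) ∧_) (dec-false (suc ∣ ρ ∣ ≟ ∣ τ ∣) too-large))
                      (∧-zeroʳ _)
  where too-large : suc ∣ ρ ∣ ≢ ∣ τ ∣
        too-large e = 1+n≰n (≤-trans (≤-reflexive e) (p⊆q⇒∣p∣≤∣q∣ τ⊆ρ))

interval-same : (τ σ : Subset n) → ⊕ (interval ∣ τ ∣ τ σ) ≡ τ ⊆ᵇ σ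
interval-same []            []            = refl
interval-same (outside ∷ τ) (s ∷ σ)       =
  trans (⊕-outside (interval ∣ τ ∣ (outside ∷ τ) (s ∷ σ)) (λ ρ → interval-too-large τ σ ρ s))
        (interval-same τ σ)
interval-same (inside ∷ τ)  (outside ∷ σ) =
  ⊕-zero (interval (suc ∣ τ ∣) (inside ∷ τ) (outside ∷ σ))
    (λ { (outside ∷ ρ) → refl ; (inside ∷ ρ) → ∧-zeroʳ (τ ⊆ᵇ ρ) })
interval-same (inside ∷ τ)  (inside ∷ σ)  =
  trans (⊕-inside (interval (suc ∣ τ ∣) (inside ∷ τ) (inside ∷ σ)) (λ ρ → refl))
        (interval-same τ σ)

-- Adding a new point to σ but not to τ flips the parity in the count below.
parity-step : ∀ b a c → (b ∧ (a xor c)) xor b ≡ b ∧ (not a xor c)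
parity-step false a c = refl
parity-step true  a c = trans (xor-comm (a xor c) true) (not-distribˡ-xor a c)

-- The number of (∣ τ ∣ + 1)-element sets between τ ⊆ σ is ∣ σ ∣ - ∣ τ ∣;
-- only its parity is recorded.
interval-next : (τ σ : Subset n) →
                ⊕ (interval (suc ∣ τ ∣) τ σ) ≡ τ ⊆ᵇ σ ∧ (isOdd ∣ σ ∣ xor isOdd ∣ τ ∣)
interval-next []            []            = refl
interval-next (outside ∷ τ) (outside ∷ σ) =
  trans (⊕-outside (interval (suc ∣ τ ∣) (outside ∷ τ) (outside ∷ σ)) (λ ρ → ∧-zeroʳ (τ ⊆ᵇ ρ)))
        (interval-next τ σ)
interval-next (outside ∷ τ) (inside ∷ σ)  = begin
  ⊕ (interval (suc ∣ τ ∣) (outside ∷ τ) (inside ∷ σ))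
    ≡⟨ ⊕-split (interval (suc ∣ τ ∣) (outside ∷ τ) (inside ∷ σ)) ⟩
  ⊕ (interval (suc ∣ τ ∣) τ σ) xor ⊕ (interval ∣ τ ∣ τ σ)
    ≡⟨ cong₂ _xor_ (interval-next τ σ) (interval-same τ σ) ⟩
  (τ ⊆ᵇ σ ∧ (isOdd ∣ σ ∣ xor isOdd ∣ τ ∣)) xor τ ⊆ᵇ σ
    ≡⟨ parity-step (τ ⊆ᵇ σ) (isOdd ∣ σ ∣) (isOdd ∣ τ ∣) ⟩
  τ ⊆ᵇ σ ∧ (not (isOdd ∣ σ ∣) xor isOdd ∣ τ ∣)
    ∎
interval-next (inside ∷ τ)  (outside ∷ σ) =
  ⊕-zero (interval (suc (suc ∣ τ ∣)) (inside ∷ τ) (outside ∷ σ))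
    (λ { (outside ∷ ρ) → refl ; (inside ∷ ρ) → ∧-zeroʳ (τ ⊆ᵇ ρ) })
interval-next (inside ∷ τ)  (inside ∷ σ)  = begin
  ⊕ (interval (suc (suc ∣ τ ∣)) (inside ∷ τ) (inside ∷ σ))
    ≡⟨ ⊕-inside (interval (suc (suc ∣ τ ∣)) (inside ∷ τ) (inside ∷ σ)) (λ ρ → refl) ⟩
  ⊕ (interval (suc ∣ τ ∣) τ σ)
    ≡⟨ interval-next τ σ ⟩
  τ ⊆ᵇ σ ∧ (isOdd ∣ σ ∣ xor isOdd ∣ τ ∣)
    ≡⟨ cong (τ ⊆ᵇ σ ∧_) (xor-annihilates-not (isOdd ∣ σ ∣) (isOdd ∣ τ ∣)) ⟨
  τ ⊆ᵇ σ ∧ (not (isOdd ∣ σ ∣) xor not (isOdd ∣ τ ∣))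
    ∎

-- Parity of the number of d-faces ρ of a (d+1)-set σ ∌ v whose cone
-- ρ ∪ {v} contains a given d-set τ: it is odd exactly when τ ⊆ σ.
-- Case v ∉ τ: such ρ satisfy τ ⊆ ρ ⊆ σ with ∣ ρ ∣ = ∣ τ ∣.
cone-incidences-off : ∀ {v : Fin n} {τ} (σ : Subset n) → v ∉ τ →
  ⊕ (λ ρ → face ∣ τ ∣ σ ρ ∧ τ ⊆ᵇ (ρ ∪ ⁅ v ⁆)) ≡ τ ⊆ᵇ σ
cone-incidences-off {v = v} {τ} σ v∉τ = begin
  ⊕ (λ ρ → face ∣ τ ∣ σ ρ ∧ τ ⊆ᵇ (ρ ∪ ⁅ v ⁆))
    ≡⟨ ⊕-cong (λ ρ → cong (face ∣ τ ∣ σ ρ ∧_) (⊆ᵇ-cone ρ v∉τ)) ⟩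
  ⊕ (λ ρ → face ∣ τ ∣ σ ρ ∧ τ ⊆ᵇ ρ)
    ≡⟨ ⊕-cong (λ ρ → ∧-comm (face ∣ τ ∣ σ ρ) (τ ⊆ᵇ ρ)) ⟩
  ⊕ (interval ∣ τ ∣ τ σ)
    ≡⟨ interval-same τ σ ⟩
  τ ⊆ᵇ σ
    ∎

-- Case τ = τ₀ ∪ {v}: such ρ satisfy τ₀ ⊆ ρ ⊆ σ with ∣ ρ ∣ = ∣ τ₀ ∣ + 1,
-- and there are ∣ σ ∣ - ∣ τ₀ ∣ = 2 of them (or none), while τ ⊈ σ.
cone-incidences-on : ∀ {v : Fin n} {τ₀} (σ : Subset n) → v ∉ τ₀ → v ∉ σ →
  ∣ σ ∣ ≡ suc (suc ∣ τ₀ ∣) →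
  ⊕ (λ ρ → face (suc ∣ τ₀ ∣) σ ρ ∧ (τ₀ ∪ ⁅ v ⁆) ⊆ᵇ (ρ ∪ ⁅ v ⁆)) ≡ (τ₀ ∪ ⁅ v ⁆) ⊆ᵇ σ
cone-incidences-on {v = v} {τ₀} σ v∉τ₀ v∉σ σ-size = begin
  ⊕ (λ ρ → face (suc ∣ τ₀ ∣) σ ρ ∧ (τ₀ ∪ ⁅ v ⁆) ⊆ᵇ (ρ ∪ ⁅ v ⁆))
    ≡⟨ ⊕-cong (λ ρ → trans (cong (face (suc ∣ τ₀ ∣) σ ρ ∧_) (⊆ᵇ-cones ρ v∉τ₀))
                           (∧-comm (face (suc ∣ τ₀ ∣) σ ρ) (τ₀ ⊆ᵇ ρ))) ⟩
  ⊕ (interval (suc ∣ τ₀ ∣) τ₀ σ)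
    ≡⟨ interval-next τ₀ σ ⟩
  τ₀ ⊆ᵇ σ ∧ (isOdd ∣ σ ∣ xor isOdd ∣ τ₀ ∣)
    ≡⟨ cong (λ k → τ₀ ⊆ᵇ σ ∧ (isOdd k xor isOdd ∣ τ₀ ∣)) σ-size ⟩
  τ₀ ⊆ᵇ σ ∧ (not (not (isOdd ∣ τ₀ ∣)) xor isOdd ∣ τ₀ ∣)
    ≡⟨ cong (λ b → τ₀ ⊆ᵇ σ ∧ (b xor isOdd ∣ τ₀ ∣)) (not-involutive (isOdd ∣ τ₀ ∣)) ⟩
  τ₀ ⊆ᵇ σ ∧ (isOdd ∣ τ₀ ∣ xor isOdd ∣ τ₀ ∣)
    ≡⟨ cong (τ₀ ⊆ᵇ σ ∧_) (xor-same (isOdd ∣ τ₀ ∣)) ⟩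
  τ₀ ⊆ᵇ σ ∧ false
    ≡⟨ ∧-zeroʳ (τ₀ ⊆ᵇ σ) ⟩
  false
    ≡⟨ dec-false (τ₀ ∪ ⁅ v ⁆ ⊆? σ) (λ τ⊆σ → v∉σ (τ⊆σ (q⊆p∪q τ₀ ⁅ v ⁆ (x∈⁅x⁆ v)))) ⟨
  (τ₀ ∪ ⁅ v ⁆) ⊆ᵇ σ
    ∎

cone-incidences : ∀ {v : Fin n} {τ σ : Subset n} → ∣ τ ∣ ≡ d → ∣ σ ∣ ≡ suc d → v ∉ σ →
  ⊕ (λ ρ → face d σ ρ ∧ τ ⊆ᵇ (ρ ∪ ⁅ v ⁆)) ≡ τ ⊆ᵇ σ
cone-incidences {v = v} {τ} {σ} refl σ-size v∉σ with v ∈? τ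
... | no v∉τ = cone-incidences-off σ v∉τ
... | yes v∈τ with split-off v∈τ
...   | τ₀ , v∉τ₀ , refl rewrite ∣cone∣ v∉τ₀ = cone-incidences-on σ v∉τ₀ v∉σ σ-size

δ-value : (A : FaceSet n) (σ : Subset n) → ∣ σ ∣ ≡ suc d →
          coboundaryOf d A σ ≡ ⊕ (λ τ → A τ ∧ τ ⊆ᵇ σ)
δ-value {d = d} A σ σ-size =
  cong₂ _∧_ (trans (isYes≗does (∣ σ ∣ ≟ suc d)) (dec-true (∣ σ ∣ ≟ suc d) σ-size))
            (⊕-cong (λ τ → cong (A τ ∧_) (isYes≗does (τ ⊆? σ))))

coboundary-size : {C : FaceSet n} → IsCoboundary d C → ∀ {σ} → σ ∈F C → ∣ σ ∣ ≡ suc d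
coboundary-size {d = d} (A , _ , C≗δA) {σ} σ∈C = fromDoes (∣ σ ∣ ≟ suc d)
  (trans (sym (isYes≗does (∣ σ ∣ ≟ suc d)))
         (∧-elimˡ _ (oddIncidence A σ) (trans (sym (C≗δA σ)) σ∈C)))

link-cone : ∀ {v : Fin n} {τ} (C : FaceSet n) → v ∉ τ → link v C τ ≡ C (τ ∪ ⁅ v ⁆)
link-cone {v = v} {τ} C v∉τ =
  cong (λ b → not b ∧ C (τ ∪ ⁅ v ⁆)) (trans (isYes≗does (v ∈? τ)) (dec-false (v ∈? τ) v∉τ))

link-member : ∀ {v : Fin n} {τ} (C : FaceSet n) → τ ∈F link v C → v ∉ τ × (τ ∪ ⁅ v ⁆) ∈F C
link-member {v = v} {τ} C τ∈K = v∉τ , trans (sym (link-cone C v∉τ)) τ∈K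
  where
  v∉τ : v ∉ τ
  v∉τ v∈τ with () ← trans (cong (λ b → not b ∧ C (τ ∪ ⁅ v ⁆))
                               (sym (trans (isYes≗does (v ∈? τ)) (dec-true (v ∈? τ) v∈τ))))
                         τ∈K

link-mono : ∀ {v : Fin n} {C C' : FaceSet n} → C' ⊆F C → link v C' ⊆F link v C
link-mono {C = C} {C'} C'⊆C τ τ∈K' with link-member C' τ∈K'
... | v∉τ , τ+v∈C' = trans (link-cone C v∉τ) (C'⊆C _ τ+v∈C')

link-size : ∀ {v : Fin n} {C : FaceSet n} → IsCoboundary d C → ∀ {τ} → τ ∈F link v C → ∣ τ ∣ ≡ d
link-size {C = C} C-cob τ∈K with link-member C τ∈K
... | v∉τ , τ+v∈C = suc-injective (trans (sym (∣cone∣ v∉τ)) (coboundary-size C-cob τ+v∈C))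

-- Expanding C = δA, the
-- right-hand side counts pairs (ρ, τ) with τ ∈ A and τ ⊆ ρ ∪ {v}; summing
-- over ρ first, cone-incidences leaves exactly the τ ∈ A with τ ⊆ σ.
cocycle : ∀ {v : Fin n} {C : FaceSet n} {σ} → IsCoboundary d C →
          ∣ σ ∣ ≡ suc d → v ∉ σ → C σ ≡ ⊕ (λ ρ → face d σ ρ ∧ link v C ρ)
cocycle {n} {d} {v} {C} {σ} (A , A-size , C≗δA) σ-size v∉σ = sym (begin
  ⊕ (λ ρ → face d σ ρ ∧ link v C ρ)
    ≡⟨ ⊕-cong (λ ρ → ∧-cong-if (face d σ ρ) (link-as-sum ρ)) ⟩
  ⊕ (λ ρ → face d σ ρ ∧ ⊕ (λ τ → A τ ∧ τ ⊆ᵇ (ρ ∪ ⁅ v ⁆)))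
    ≡⟨ ⊕-cong (λ ρ → xorSum-scale S (face d σ ρ) _) ⟩
  ⊕ (λ ρ → ⊕ (λ τ → face d σ ρ ∧ (A τ ∧ τ ⊆ᵇ (ρ ∪ ⁅ v ⁆))))
    ≡⟨ xorSum-swap S S (λ ρ τ → face d σ ρ ∧ (A τ ∧ τ ⊆ᵇ (ρ ∪ ⁅ v ⁆))) ⟩
  ⊕ (λ τ → ⊕ (λ ρ → face d σ ρ ∧ (A τ ∧ τ ⊆ᵇ (ρ ∪ ⁅ v ⁆))))
    ≡⟨ ⊕-cong (λ τ → ⊕-cong (λ ρ → ∧-swapˡ (face d σ ρ) (A τ) _)) ⟩
  ⊕ (λ τ → ⊕ (λ ρ → A τ ∧ (face d σ ρ ∧ τ ⊆ᵇ (ρ ∪ ⁅ v ⁆))))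
    ≡⟨ ⊕-cong (λ τ → xorSum-scale S (A τ) _) ⟨
  ⊕ (λ τ → A τ ∧ ⊕ (λ ρ → face d σ ρ ∧ τ ⊆ᵇ (ρ ∪ ⁅ v ⁆)))
    ≡⟨ ⊕-cong (λ τ → ∧-cong-if (A τ) (λ τ∈A → cone-incidences {τ = τ} (A-size τ τ∈A) σ-size v∉σ)) ⟩
  ⊕ (λ τ → A τ ∧ τ ⊆ᵇ σ)
    ≡⟨ trans (C≗δA σ) (δ-value A σ σ-size) ⟨
  C σ
    ∎)
  where
  S : List (Subset n)
  S = allSubsets n

  link-as-sum : ∀ ρ → face d σ ρ ≡ true → link v C ρ ≡ ⊕ (λ τ → A τ ∧ τ ⊆ᵇ (ρ ∪ ⁅ v ⁆))
  link-as-sum ρ ρ-face with face-elim σ ρ ρ-face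
  ... | ρ⊆σ , ρ-size = begin
    link v C ρ                ≡⟨ link-cone C v∉ρ ⟩
    C (ρ ∪ ⁅ v ⁆)             ≡⟨ C≗δA (ρ ∪ ⁅ v ⁆) ⟩
    coboundaryOf d A (ρ ∪ ⁅ v ⁆) ≡⟨ δ-value A (ρ ∪ ⁅ v ⁆) (trans (∣cone∣ v∉ρ) (cong suc ρ-size)) ⟩
    ⊕ (λ τ → A τ ∧ τ ⊆ᵇ (ρ ∪ ⁅ v ⁆)) ∎
    where v∉ρ : v ∉ ρ
          v∉ρ = v∉σ ∘ ρ⊆σ

two-face-value : ∀ {v : Fin n} {D : FaceSet n} {σ τ τ'} → IsCoboundary d D →
  ∣ σ ∣ ≡ suc d → v ∉ σ → τ ≢ τ' → face d σ τ ≡ true → face d σ τ' ≡ true →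
  (∀ ρ → face d σ ρ ≡ true → ρ ∈F link v D → ρ ≡ τ ⊎ ρ ≡ τ') →
  D σ ≡ link v D τ xor link v D τ'
two-face-value {d = d} {v} {D} {σ} {τ} {τ'} D-cob σ-size v∉σ τ≢τ' τ-face τ'-face only = begin
  D σ
    ≡⟨ cocycle D-cob σ-size v∉σ ⟩
  ⊕ (λ ρ → face d σ ρ ∧ link v D ρ)
    ≡⟨ ⊕-pair τ≢τ' (λ ρ e → only ρ (∧-elimˡ _ _ e) (∧-elimʳ (face d σ ρ) _ e)) ⟩
  (face d σ τ ∧ link v D τ) xor (face d σ τ' ∧ link v D τ')
    ≡⟨ cong₂ (λ a b → (a ∧ link v D τ) xor (b ∧ link v D τ')) τ-face τ'-face ⟩
  link v D τ xor link v D τ'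
    ∎

-- Λ-adjacent faces τ, τ' of link_v C are either both or neither in the link
-- of a sub-coboundary C' ⊆ C: by the two-face formula C (τ ∪ τ') = 1 + 1 = 0,
-- so C' (τ ∪ τ') = 0, which the two-face formula for C' turns into
-- [τ ∈ link_v C'] = [τ' ∈ link_v C'].
Λ-adjacent-agree : ∀ {v : Fin n} {C C' : FaceSet n} {τ τ'} →
  IsCoboundary d C → IsCoboundary d C' → C' ⊆F C →
  ΛAdjacent d (link v C) τ τ' → link v C' τ ≡ link v C' τ'
Λ-adjacent-agree {n = n} {d = d} {v = v} {C} {C'} {τ} {τ'} C-cob C'-cob C'⊆C (τ∈K , τ'∈K , σ-size , only) =
  xor-false⇒≡ _ _ (begin
    link v C' τ xor link v C' τ'   ≡⟨ two-face-value C'-cob σ-size v∉σ τ≢τ' τ-face τ'-face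
                                        (λ ρ ρ-face ρ∈K' → onlyᶠ ρ ρ-face (link-mono C'⊆C ρ ρ∈K')) ⟨
    C' σ                           ≡⟨ ¬-not (λ σ∈C' → true≢false (trans (sym (C'⊆C σ σ∈C')) σ∉C)) ⟩
    false                          ∎)
  where
  σ : Subset n
  σ = τ ∪ τ'
  τ-size : ∣ τ ∣ ≡ d
  τ-size = link-size C-cob τ∈K
  τ'-size : ∣ τ' ∣ ≡ d
  τ'-size = link-size C-cob τ'∈K
  onlyᶠ : ∀ ρ → face d σ ρ ≡ true → ρ ∈F link v C → ρ ≡ τ ⊎ ρ ≡ τ'
  onlyᶠ ρ ρ-face with face-elim σ ρ ρ-face
  ... | ρ⊆σ , ρ-size = only ρ ρ-size ρ⊆σ
  v∉σ : v ∉ σ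
  v∉σ v∈σ with x∈p∪q⁻ τ τ' v∈σ
  ... | inj₁ v∈τ  = proj₁ (link-member C τ∈K) v∈τ
  ... | inj₂ v∈τ' = proj₁ (link-member C τ'∈K) v∈τ'
  τ≢τ' : τ ≢ τ'
  τ≢τ' refl = 1+n≰n (≤-reflexive (trans (sym σ-size) (trans (cong ∣_∣ (∪-idem τ)) τ-size)))
  τ-face : face d σ τ ≡ true
  τ-face = face-intro σ τ (p⊆p∪q τ') τ-size
  τ'-face : face d σ τ' ≡ true
  τ'-face = face-intro σ τ' (q⊆p∪q τ τ') τ'-size
  σ∉C : C σ ≡ false
  σ∉C = begin
    C σ                          ≡⟨ two-face-value C-cob σ-size v∉σ τ≢τ' τ-face τ'-face onlyᶠ ⟩
    link v C τ xor link v C τ'   ≡⟨ cong₂ _xor_ τ∈K τ'∈K ⟩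
    false                        ∎

Λ-path-agree : ∀ {v : Fin n} {C C' : FaceSet n} {τ τ'} →
  IsCoboundary d C → IsCoboundary d C' → C' ⊆F C →
  Star (ΛAdjacent d (link v C)) τ τ' → link v C' τ ≡ link v C' τ'
Λ-path-agree {v = v} {C' = C'} C-cob C'-cob C'⊆C =
  fold (λ τ τ' → link v C' τ ≡ link v C' τ')
       (λ adj → trans (Λ-adjacent-agree C-cob C'-cob C'⊆C adj)) refl

-- A nonempty coboundary has a nonempty link: a face through v gives a link
-- face directly, a face σ ∌ v has an odd number of d-faces in the link.
nonempty-link : ∀ {v : Fin n} {D : FaceSet n} → IsCoboundary d D → NonemptyF D →
                NonemptyF (link v D)
nonempty-link {d = d} {v} {D} D-cob (σ , σ∈D) with v ∈? σ
... | yes v∈σ with split-off v∈σ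
...   | τ₀ , v∉τ₀ , refl = τ₀ , trans (link-cone D v∉τ₀) σ∈D
nonempty-link {d = d} {v} {D} D-cob (σ , σ∈D) | no v∉σ
  with xorSum-witness (allSubsets _) (λ ρ → face d σ ρ ∧ link v D ρ)
         (trans (sym (cocycle D-cob (coboundary-size D-cob σ∈D) v∉σ)) σ∈D)
... | ρ , e = ρ , ∧-elimʳ (face d σ ρ) _ e

-- A coboundary is determined by its link: C (τ ∪ {v}) is a link value, and
-- on sets avoiding v the cocycle identity expresses C through the link.
link-determines : ∀ {v : Fin n} {C C' : FaceSet n} → IsCoboundary d C → IsCoboundary d C' →
                  (∀ τ → link v C τ ≡ link v C' τ) → C ⊆F C'
link-determines {v = v} {C} {C'} C-cob C'-cob same-link σ σ∈C with v ∈? σ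
... | yes v∈σ with split-off v∈σ
...   | τ₀ , v∉τ₀ , refl = begin
  C' (τ₀ ∪ ⁅ v ⁆)    ≡⟨ link-cone C' v∉τ₀ ⟨
  link v C' τ₀       ≡⟨ same-link τ₀ ⟨
  link v C τ₀        ≡⟨ link-cone C v∉τ₀ ⟩
  C (τ₀ ∪ ⁅ v ⁆)     ≡⟨ σ∈C ⟩
  true               ∎
link-determines {v = v} {C} {C'} C-cob C'-cob same-link σ σ∈C | no v∉σ = begin
  C' σ                                   ≡⟨ cocycle C'-cob σ-size v∉σ ⟩
  ⊕ (λ ρ → face _ σ ρ ∧ link v C' ρ)     ≡⟨ ⊕-cong (λ ρ → cong (face _ σ ρ ∧_) (same-link ρ)) ⟨
  ⊕ (λ ρ → face _ σ ρ ∧ link v C ρ)      ≡⟨ cocycle C-cob σ-size v∉σ ⟨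
  C σ                                    ≡⟨ σ∈C ⟩
  true                                   ∎
  where σ-size : ∣ σ ∣ ≡ suc _
        σ-size = coboundary-size C-cob σ∈C

⊆F-antisym : {P Q : FaceSet n} → P ⊆F Q → Q ⊆F P → ∀ σ → P σ ≡ Q σ
⊆F-antisym {P = P} {Q} P⊆Q Q⊆P σ with P σ in Pσ
... | true  = sym (P⊆Q σ Pσ)
... | false = sym (¬-not (λ σ∈Q → true≢false (trans (sym (Q⊆P σ σ∈Q)) Pσ)))

-- Any nonempty sub-coboundary C' ⊆ C has a nonempty link contained in the
-- Λ-connected link_v C and closed under Λ-adjacency there, so the two links
-- coincide, and then so do C' and C.
claim7 : (n d : ℕ) → d ≥ 1 → (C : FaceSet n) → IsCoboundary d C →
         (v : Fin n) → ΛConnected d (link v C) → IsHypercut d C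
claim7 n d _ C C-cob v ((τ₀ , τ₀∈K) , Λ-path) =
  C-cob , (τ₀ ∪ ⁅ v ⁆ , proj₂ (link-member C τ₀∈K)) , minimal
  where
  minimal : ∀ C' → IsCoboundary d C' → NonemptyF C' → C' ⊆F C → C ⊆F C'
  minimal C' C'-cob C'-nonempty C'⊆C =
    link-determines C-cob C'-cob (⊆F-antisym K⊆K' (link-mono C'⊆C))
    where
    K⊆K' : link v C ⊆F link v C'
    K⊆K' τ τ∈K with nonempty-link C'-cob C'-nonempty
    ... | τ₁ , τ₁∈K' =
      trans (sym (Λ-path-agree C-cob C'-cob C'⊆C (Λ-path τ₁ τ (link-mono C'⊆C τ₁ τ₁∈K') τ∈K)))
            τ₁∈K'
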